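{- For every $m\in\mathbb{N}$, as an identity of rational functions in indeterminates $x,y$, \[ \sum_{r=0}^{m}\sum_{s=0}^{m-r}\binom{m-r+1}{s}\binom{m-s}{r}\frac{x^ry^s}{(1-x)^{r+s}(1-y)^{r+s}}=\frac{1-x^{m+2}y^{m+2}-x(1-x^{m+1}y^{m+1})-(1-xy)y^{m+1}}{(1-xy)(1-x)^{m+1}(1-y)^{m+1}}. \]
   Context: $\mathbb{N}$ denotes the positive integers. -}

module Defs where

open import Level using (Level)
open import Data.Nat as ℕ using (ℕ; zero; suc; _∸_)
open import Data.Nat.Combinatorics using (_C_)
open import Algebra.Bundles using (CommutativeRing; Semiring)
import Algebra.Definitions.RawSemiring as RS

module Cor25 {c ℓ : Level} (R : CommutativeRing c ℓ) where
  open CommutativeRing R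
  open RS (Semiring.rawSemiring semiring) using (_^_; _×_)

  sumTo : ℕ → (ℕ → Carrier) → Carrier
  sumTo zero    f = f 0
  sumTo (suc n) f = sumTo n f + f (suc n)

  -- Left-hand side, with u = (1-x)⁻¹ and v = (1-y)⁻¹ :
  -- Σ_{r=0}^{m} Σ_{s=0}^{m-r} C(m-r+1,s) C(m-s,r) x^r y^s (1-x)^{-(r+s)} (1-y)^{-(r+s)}
  lhs : ℕ → (x y u v : Carrier) → Carrier
  lhs m x y u v =
    sumTo m (λ r → sumTo (m ∸ r) (λ s →
      (((suc (m ∸ r)) C s) ×
       (((m ∸ s) C r) × ((x ^ r) * (y ^ s) * (u ^ (r ℕ.+ s)) * (v ^ (r ℕ.+ s)))))))

  -- Right-hand side, with w = (1-xy)⁻¹ :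
  -- (1 - x^{m+2}y^{m+2} - x(1 - x^{m+1}y^{m+1}) - (1-xy) y^{m+1}) (1-xy)^{-1} (1-x)^{-(m+1)} (1-y)^{-(m+1)}
  rhs : ℕ → (x y u v w : Carrier) → Carrier
  rhs m x y u v w =
    (1# - (x ^ (suc (suc m))) * (y ^ (suc (suc m)))
        - x * (1# - (x ^ (suc m)) * (y ^ (suc m)))
        - (1# - x * y) * (y ^ (suc m)))
    * w * (u ^ (suc m)) * (v ^ (suc m))

-- Put X = x/((1-x)(1-y)) and Y = y/((1-x)(1-y)). The left-hand side plus the single term Y^(m+1)
-- is A_m = Σ a_m(r,s) X^r Y^s with a_m(r,s) = C(m-r+1,s) C(m-s,r). Together with
-- B_m = Σ b_m(r,s) X^r Y^s, b_m(r,s) = C(m-s,r) C(m-r,s), Pascal's rule gives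
--   a_{m+1}(r,s) = a_m(r,s) + a_m(r,s-1) + b_m(r-1,s)   and   b_{m+1}(r,s) = a_m(r,s) + b_m(r-1,s),
-- that is A_{m+1} = (1+Y) A_m + X B_m and B_{m+1} = A_m + X B_m. Writing α = 1/((1-x)(1-y)),
-- this linear recurrence is solved by
--   (1-xy) B_m = α^m (1 - x^(m+1) y^(m+1)),
--   (1-xy) A_m = α^(m+1) ((1 - x^(m+2) y^(m+2)) - x (1 - x^(m+1) y^(m+1))),
-- and subtracting Y^(m+1) = y^(m+1) α^(m+1) and dividing by 1-xy gives the claimed identity.
module Submission where

open import Level using (Level)
open import Algebra.Bundles using (CommutativeRing; Semiring)
import Algebra.Definitions.RawSemiring as RawSemiring
open import Data.Nat as ℕ using (ℕ; zero; suc; _∸_; _<_; _≤_; _≤′_; s≤s)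
open import Data.Nat.Combinatorics using (_C_)
import Data.Nat.Properties as ℕ
open import Relation.Binary.PropositionalEquality as ≡ using (_≡_)

open import Defs

-- Identities involving subtraction need integer coefficients; ℤ maps into every commutative ring.
module IntegerCoefficientSolver {c ℓ : Level} (R : CommutativeRing c ℓ) where
  open import Data.Integer as ℤ using (ℤ; +_; -[1+_])
  import Data.Integer.Properties as ℤ
  open import Data.Sign as Sign using (Sign)
  open import Data.Maybe using (Maybe; just; nothing)
  open import Relation.Nullary using (yes; no)
  import Algebra.Solver.Ring.AlmostCommutativeRing as ACR
  open CommutativeRing R
  open import Algebra.Properties.Ring ring
    using (-0#≈0#; -‿involutive; -‿distribˡ-*; -‿distribʳ-*; -‿+-comm)
  open import Algebra.Properties.Semiring.Mult.TCOptimised semiring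
    using (_×_; ×-homo-+; ×1-homo-*; 1+×)
  open import Relation.Binary.Reasoning.Setoid setoid

  -- With the tail-call-optimised _×_, fromℤ (+ 1) reduces to 1#, so the solver's constant 𝟏
  -- denotes 1# on the nose.
  fromℤ : ℤ → Carrier
  fromℤ (+ n)      = n × 1#
  fromℤ (-[1+ n ]) = - (suc n × 1#)

  signed : Sign → Carrier → Carrier
  signed Sign.+ a = a
  signed Sign.- a = - a

  fromℤ-sign-abs : ∀ i → fromℤ i ≈ signed (ℤ.sign i) (ℤ.∣ i ∣ × 1#)
  fromℤ-sign-abs (+ n)    = refl
  fromℤ-sign-abs -[1+ n ] = refl

  fromℤ-◃ : ∀ s n → fromℤ (s ℤ.◃ n) ≈ signed s (n × 1#)
  fromℤ-◃ Sign.+ zero    = refl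
  fromℤ-◃ Sign.- zero    = sym -0#≈0#
  fromℤ-◃ Sign.+ (suc n) = refl
  fromℤ-◃ Sign.- (suc n) = refl

  signed-cong : ∀ s {a b} → a ≈ b → signed s a ≈ signed s b
  signed-cong Sign.+ a≈b = a≈b
  signed-cong Sign.- a≈b = -‿cong a≈b

  signed-* : ∀ s t a b → signed (s Sign.* t) (a * b) ≈ signed s a * signed t b
  signed-* Sign.+ Sign.+ a b = refl
  signed-* Sign.+ Sign.- a b = -‿distribʳ-* a b
  signed-* Sign.- Sign.+ a b = -‿distribˡ-* a b
  signed-* Sign.- Sign.- a b = begin
    a * b        ≈⟨ -‿involutive (a * b) ⟨
    - - (a * b)  ≈⟨ -‿cong (-‿distribˡ-* a b) ⟩
    - (- a * b)  ≈⟨ -‿distribʳ-* (- a) b ⟩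
    - a * - b    ∎

  -‿cancel-+ˡ : ∀ a b c → (a + b) - (a + c) ≈ b - c
  -‿cancel-+ˡ a b c = begin
    (a + b) - (a + c)    ≈⟨ +-congˡ (-‿+-comm a c) ⟨
    (a + b) + (- a - c)  ≈⟨ +-congʳ (+-comm a b) ⟩
    (b + a) + (- a - c)  ≈⟨ +-assoc b a _ ⟩
    b + (a + (- a - c))  ≈⟨ +-congˡ (+-assoc a (- a) (- c)) ⟨
    b + ((a - a) - c)    ≈⟨ +-congˡ (+-congʳ (-‿inverseʳ a)) ⟩
    b + (0# - c)         ≈⟨ +-congˡ (+-identityˡ (- c)) ⟩
    b - c                ∎

  fromℤ-⊖ : ∀ m n → fromℤ (m ℤ.⊖ n) ≈ m × 1# - n × 1#
  fromℤ-⊖ zero    zero    = sym (-‿inverseʳ 0#)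
  fromℤ-⊖ zero    (suc n) = sym (+-identityˡ _)
  fromℤ-⊖ (suc m) zero    = sym (trans (+-congˡ -0#≈0#) (+-identityʳ _))
  fromℤ-⊖ (suc m) (suc n) = begin
    fromℤ (suc m ℤ.⊖ suc n)        ≡⟨ ≡.cong fromℤ (ℤ.[1+m]⊖[1+n]≡m⊖n m n) ⟩
    fromℤ (m ℤ.⊖ n)                ≈⟨ fromℤ-⊖ m n ⟩
    m × 1# - n × 1#                ≈⟨ -‿cancel-+ˡ 1# (m × 1#) (n × 1#) ⟨
    (1# + m × 1#) - (1# + n × 1#)  ≈⟨ +-cong (1+× m 1#) (-‿cong (1+× n 1#)) ⟨
    suc m × 1# - suc n × 1#        ∎

  fromℤ-+ : ∀ i j → fromℤ (i ℤ.+ j) ≈ fromℤ i + fromℤ j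
  fromℤ-+ (+ m)    (+ n)    = ×-homo-+ 1# m n
  fromℤ-+ (+ m)    -[1+ n ] = fromℤ-⊖ m (suc n)
  fromℤ-+ -[1+ m ] (+ n)    = trans (fromℤ-⊖ n (suc m)) (+-comm _ _)
  fromℤ-+ -[1+ m ] -[1+ n ] = begin
    - (suc (suc (m ℕ.+ n)) × 1#)   ≡⟨ ≡.cong (λ k → - (suc k × 1#)) (ℕ.+-suc m n) ⟨
    - ((suc m ℕ.+ suc n) × 1#)     ≈⟨ -‿cong (×-homo-+ 1# (suc m) (suc n)) ⟩
    - (suc m × 1# + suc n × 1#)    ≈⟨ -‿+-comm _ _ ⟨
    - (suc m × 1#) - (suc n × 1#)  ∎

  fromℤ-* : ∀ i j → fromℤ (i ℤ.* j) ≈ fromℤ i * fromℤ j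
  fromℤ-* i j = begin
    fromℤ (s ℤ.◃ (∣i∣ ℕ.* ∣j∣))      ≈⟨ fromℤ-◃ s (∣i∣ ℕ.* ∣j∣) ⟩
    signed s ((∣i∣ ℕ.* ∣j∣) × 1#)    ≈⟨ signed-cong s (×1-homo-* ∣i∣ ∣j∣) ⟩
    signed s (∣i∣ × 1# * ∣j∣ × 1#)   ≈⟨ signed-* (ℤ.sign i) (ℤ.sign j) _ _ ⟩
    signed (ℤ.sign i) (∣i∣ × 1#) * signed (ℤ.sign j) (∣j∣ × 1#)
                                     ≈⟨ *-cong (fromℤ-sign-abs i) (fromℤ-sign-abs j) ⟨
    fromℤ i * fromℤ j                ∎
    where
    s : Sign
    s = ℤ.sign i Sign.* ℤ.sign j
    ∣i∣ ∣j∣ : ℕ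
    ∣i∣ = ℤ.∣ i ∣
    ∣j∣ = ℤ.∣ j ∣

  fromℤ-neg : ∀ i → fromℤ (ℤ.- i) ≈ - fromℤ i
  fromℤ-neg (+ zero)  = sym -0#≈0#
  fromℤ-neg (+ suc n) = refl
  fromℤ-neg -[1+ n ]  = sym (-‿involutive _)

  homomorphism : ℤ.+-*-rawRing ACR.-Raw-AlmostCommutative⟶ ACR.fromCommutativeRing R
  homomorphism = record
    { ⟦_⟧    = fromℤ
    ; +-homo = fromℤ-+
    ; *-homo = fromℤ-*
    ; -‿homo = fromℤ-neg
    ; 0-homo = refl
    ; 1-homo = refl
    }

  fromℤ-≟ : ∀ i j → Maybe (fromℤ i ≈ fromℤ j)
  fromℤ-≟ i j with i ℤ.≟ j
  ... | yes ≡.refl = just refl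
  ... | no _       = nothing

  open import Algebra.Solver.Ring ℤ.+-*-rawRing (ACR.fromCommutativeRing R) homomorphism fromℤ-≟ public

  𝟏 : ∀ {n} → Polynomial n
  𝟏 = con (+ 1)

module Coefficients where
  open import Data.Nat using (_+_; _*_; _≤?_)
  open import Data.Nat.Properties
  open import Data.Nat.Combinatorics using (nCn≡1; nCk+nC[k+1]≡[n+1]C[k+1])
  open import Data.Nat.Combinatorics.Specification using (k>n⇒nCk≡0)
  open import Data.Nat.Tactic.RingSolver using (solve-∀)
  open import Relation.Binary.PropositionalEquality
  open import Relation.Nullary using (yes; no)

  Array : Set
  Array = ℕ → ℕ → ℕ

  a b : ℕ → Array
  a m r s = (suc (m ∸ r) C s) * ((m ∸ s) C r)
  b m r s = ((m ∸ s) C r) * ((m ∸ r) C s)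

  shiftX shiftY : Array → Array
  shiftX f zero    s       = 0
  shiftX f (suc r) s       = f r s
  shiftY f r       zero    = 0
  shiftY f r       (suc s) = f r s

  [m∸n]Co≡0 : ∀ m n {o} → m < o → (m ∸ n) C o ≡ 0
  [m∸n]Co≡0 m n m<o = k>n⇒nCk≡0 (≤-<-trans (m∸n≤m m n) m<o)

  a-at-suc : ∀ m r s → a m (suc r) s ≡ ((m ∸ r) C s) * ((m ∸ s) C suc r)
  a-at-suc m r s with suc r ≤? m
  ... | yes r<m rewrite +-∸-assoc 1 r<m = refl
  ... | no  r≮m rewrite [m∸n]Co≡0 m s (≰⇒> r≮m) | *-zeroʳ (suc (m ∸ suc r) C s) =
    sym (*-zeroʳ ((m ∸ r) C s))

  -- For s > m both sides vanish, so Pascal's rule survives the truncated subtraction.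
  pascal-∸ : ∀ m r s →
    ((suc m ∸ s) C suc r) * ((m ∸ r) C s) ≡ (((m ∸ s) C r) + ((m ∸ s) C suc r)) * ((m ∸ r) C s)
  pascal-∸ m r s with s ≤? m
  ... | yes s≤m rewrite +-∸-assoc 1 s≤m =
    cong (_* ((m ∸ r) C s)) (sym (nCk+nC[k+1]≡[n+1]C[k+1] (m ∸ s) r))
  ... | no  s≰m rewrite m≤n⇒m∸n≡0 (≰⇒> s≰m) | [m∸n]Co≡0 m r (≰⇒> s≰m) =
    sym (*-zeroʳ (((m ∸ s) C r) + ((m ∸ s) C suc r)))

  b-suc : ∀ m r s → b (suc m) r s ≡ a m r s + shiftX (b m) r s
  b-suc m zero    s = cong (_+ 0) (sym (*-identityʳ (suc m C s)))
  b-suc m (suc r) s = begin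
    ((suc m ∸ s) C suc r) * ((m ∸ r) C s)                ≡⟨ pascal-∸ m r s ⟩
    (((m ∸ s) C r) + ((m ∸ s) C suc r)) * ((m ∸ r) C s)  ≡⟨ rearrange ((m ∸ s) C r) _ _ ⟩
    ((m ∸ r) C s) * ((m ∸ s) C suc r) + b m r s          ≡⟨ cong (_+ b m r s) (a-at-suc m r s) ⟨
    a m (suc r) s + b m r s                              ∎
    where
    open ≡-Reasoning
    rearrange : ∀ p q c → (p + q) * c ≡ c * q + p * c
    rearrange = solve-∀

  a-suc : ∀ m r s → a (suc m) r s ≡ a m r s + shiftY (a m) r s + shiftX (b m) r s
  a-suc m zero    zero    = refl
  a-suc m (suc r) zero    rewrite sym (nCk+nC[k+1]≡[n+1]C[k+1] m r) =
    rearrange (m C r) (m C suc r)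
    where
    rearrange : ∀ p q → 1 * (p + q) ≡ 1 * q + 0 + p * 1
    rearrange = solve-∀
  a-suc m zero    (suc s) rewrite sym (nCk+nC[k+1]≡[n+1]C[k+1] (suc m) s) =
    rearrange (suc m C s) (suc m C suc s)
    where
    rearrange : ∀ p q → (p + q) * 1 ≡ q * 1 + p * 1 + 0
    rearrange = solve-∀
  a-suc m (suc r) (suc s) = begin
    (suc (m ∸ r) C suc s) * c  ≡⟨ cong (_* c) (nCk+nC[k+1]≡[n+1]C[k+1] (m ∸ r) s) ⟨
    (p + q) * c                ≡⟨ distrib p q c ⟩
    p * c + c * q              ≡⟨ cong (p * c +_) (pascal-∸ m r (suc s)) ⟩
    p * c + (d + e) * q        ≡⟨ rearrange p q c d e ⟩
    q * e + p * c + d * q      ≡⟨ cong₂ (λ t t′ → t + t′ + d * q)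
                                         (a-at-suc m r (suc s)) (a-at-suc m r s) ⟨
    a m (suc r) (suc s) + a m (suc r) s + b m r (suc s) ∎
    where
    open ≡-Reasoning
    p q c d e : ℕ
    p = (m ∸ r) C s
    q = (m ∸ r) C suc s
    c = (m ∸ s) C suc r
    d = (m ∸ suc s) C r
    e = (m ∸ suc s) C suc r
    distrib : ∀ p q c → (p + q) * c ≡ p * c + c * q
    distrib = solve-∀
    rearrange : ∀ p q c d e → p * c + (d + e) * q ≡ q * e + p * c + d * q
    rearrange = solve-∀

  a-vanishes-r : ∀ {m r} s → m < r → a m r s ≡ 0
  a-vanishes-r {m} {r} s m<r rewrite [m∸n]Co≡0 m s m<r = *-zeroʳ (suc (m ∸ r) C s)

  a-vanishes-s : ∀ {m s} r → suc m < s → a m r s ≡ 0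
  a-vanishes-s {m} {s} r m<s rewrite k>n⇒nCk≡0 (≤-<-trans (s≤s (m∸n≤m m r)) m<s) = refl

  b-vanishes-r : ∀ {m r} s → m < r → b m r s ≡ 0
  b-vanishes-r {m} {r} s m<r rewrite [m∸n]Co≡0 m s m<r = refl

  b-vanishes-s : ∀ {m s} r → m < s → b m r s ≡ 0
  b-vanishes-s {m} {s} r m<s rewrite [m∸n]Co≡0 m r m<s = *-zeroʳ ((m ∸ s) C r)

  a-beyond-diagonal : ∀ m r {s} → m ∸ suc r < s → a m (suc r) s ≡ 0
  a-beyond-diagonal m r {s} lt = begin-equality
    a m (suc r) s                          ≡⟨ a-at-suc m r s ⟩
    ((m ∸ r) C s) * ((m ∸ s) C suc r)      ≡⟨ cong (((m ∸ r) C s) *_) (k>n⇒nCk≡0 m∸s<1+r) ⟩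
    ((m ∸ r) C s) * 0                      ≡⟨ *-zeroʳ ((m ∸ r) C s) ⟩
    0                                      ∎
    where
    open ≤-Reasoning
    m∸s<1+r : m ∸ s < suc r
    m∸s<1+r = m<n+o⇒m∸n<o m s (begin-strict
      m                    ≤⟨ m≤n+m∸n m (suc r) ⟩
      suc r + (m ∸ suc r)  <⟨ +-monoʳ-< (suc r) lt ⟩
      suc r + s            ≡⟨ +-comm (suc r) s ⟩
      s + suc r            ∎)

  a-corner : ∀ m → a m 0 (suc m) ≡ 1
  a-corner m rewrite nCn≡1 (suc m) = refl

module _ {c ℓ : Level} (R : CommutativeRing c ℓ) where
  open CommutativeRing R
  open RawSemiring (Semiring.rawSemiring semiring) using (_^_; _×_)
  open Cor25 R using (sumTo)
  open Coefficients
  open import Algebra.Properties.CommutativeSemigroup +-commutativeSemigroup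
    using (xy∙z≈xz∙y) renaming (interchange to +-interchange)
  open import Algebra.Properties.CommutativeSemigroup *-commutativeSemigroup
    using (x∙yz≈y∙xz) renaming (interchange to *-interchange)
  open import Algebra.Properties.Monoid.Mult +-monoid
    using (×-homo-1; ×-homo-+; ×-congʳ; ×-congˡ; ×-assocˡ)
  open import Algebra.Properties.Semiring.Mult semiring using (×-comm-*)
  open import Algebra.Properties.Semiring.Exp semiring using (^-homo-*)
  open import Algebra.Properties.CommutativeSemiring.Exp commutativeSemiring using (^-distrib-*)
  open import Relation.Binary.Reasoning.Setoid setoid
  open IntegerCoefficientSolver R using (solve; _:=_; _:+_; _:*_; _:-_; 𝟏)

  sumTo-cong : ∀ n {f g : ℕ → Carrier} → (∀ i → f i ≈ g i) → sumTo n f ≈ sumTo n g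
  sumTo-cong zero    f≈g = f≈g 0
  sumTo-cong (suc n) f≈g = +-cong (sumTo-cong n f≈g) (f≈g (suc n))

  sumTo-distrib-+ : ∀ n (f g : ℕ → Carrier) → sumTo n (λ i → f i + g i) ≈ sumTo n f + sumTo n g
  sumTo-distrib-+ zero    f g = refl
  sumTo-distrib-+ (suc n) f g = trans (+-congʳ (sumTo-distrib-+ n f g)) (+-interchange _ _ _ _)

  *-distribˡ-sumTo : ∀ n z (f : ℕ → Carrier) → z * sumTo n f ≈ sumTo n (λ i → z * f i)
  *-distribˡ-sumTo zero    z f = refl
  *-distribˡ-sumTo (suc n) z f = trans (distribˡ z _ _) (+-congʳ (*-distribˡ-sumTo n z f))

  sumTo-zero : ∀ n → sumTo n (λ _ → 0#) ≈ 0#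
  sumTo-zero zero    = refl
  sumTo-zero (suc n) = trans (+-identityʳ _) (sumTo-zero n)

  sumTo-split-0 : ∀ n (f : ℕ → Carrier) → sumTo (suc n) f ≈ f 0 + sumTo n (λ i → f (suc i))
  sumTo-split-0 zero    f = refl
  sumTo-split-0 (suc n) f = trans (+-congʳ (sumTo-split-0 n f)) (+-assoc _ _ _)

  sumTo-support : ∀ {n N} (f : ℕ → Carrier) → n ≤ N →
                  (∀ i → n < i → f i ≈ 0#) → sumTo N f ≈ sumTo n f
  sumTo-support {n} f n≤N vanish = go (ℕ.≤⇒≤′ n≤N)
    where
    go : ∀ {N} → n ≤′ N → sumTo N f ≈ sumTo n f
    go ℕ.≤′-refl          = refl
    go (ℕ.≤′-step {N} le) =
      trans (+-cong (go le) (vanish (suc N) (s≤s (ℕ.≤′⇒≤ le)))) (+-identityʳ _)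

  sumTo-cong-except-0 : ∀ n {f g : ℕ → Carrier} {e} →
                        f 0 ≈ g 0 + e → (∀ i → f (suc i) ≈ g (suc i)) → sumTo n f ≈ sumTo n g + e
  sumTo-cong-except-0 zero    f₀ f₊ = f₀
  sumTo-cong-except-0 (suc n) f₀ f₊ =
    trans (+-cong (sumTo-cong-except-0 n f₀ f₊) (f₊ n)) (xy∙z≈xz∙y _ _ _)

  module GeneratingPolynomial (X Y : Carrier) where

    poly : ℕ → ℕ → Array → Carrier
    poly K L f = sumTo K (λ r → sumTo L (λ s → f r s × (X ^ r * Y ^ s)))

    poly-cong : ∀ K L {f g : Array} → (∀ r s → f r s ≡ g r s) → poly K L f ≈ poly K L g
    poly-cong K L f≡g = sumTo-cong K (λ r → sumTo-cong L (λ s → ×-congˡ (f≡g r s)))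

    poly-+ : ∀ K L (f g : Array) → poly K L (λ r s → f r s ℕ.+ g r s) ≈ poly K L f + poly K L g
    poly-+ K L f g = trans (sumTo-cong K row) (sumTo-distrib-+ K _ _)
      where
      row : ∀ r → sumTo L (λ s → (f r s ℕ.+ g r s) × (X ^ r * Y ^ s))
                ≈ sumTo L (λ s → f r s × (X ^ r * Y ^ s)) + sumTo L (λ s → g r s × (X ^ r * Y ^ s))
      row r = trans (sumTo-cong L (λ s → ×-homo-+ _ (f r s) (g r s))) (sumTo-distrib-+ L _ _)

    poly-shiftY : ∀ K L f → poly K (suc L) (shiftY f) ≈ Y * poly K L f
    poly-shiftY K L f = begin
      poly K (suc L) (shiftY f)
        ≈⟨ sumTo-cong K (λ r → trans (sumTo-split-0 L _) (+-identityˡ _)) ⟩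
      sumTo K (λ r → sumTo L (λ s → f r s × (X ^ r * (Y * Y ^ s))))
        ≈⟨ sumTo-cong K (λ r → sumTo-cong L (shift r)) ⟩
      sumTo K (λ r → sumTo L (λ s → Y * (f r s × (X ^ r * Y ^ s))))
        ≈⟨ sumTo-cong K (λ r → *-distribˡ-sumTo L Y _) ⟨
      sumTo K (λ r → Y * sumTo L (λ s → f r s × (X ^ r * Y ^ s)))
        ≈⟨ *-distribˡ-sumTo K Y _ ⟨
      Y * poly K L f
        ∎
      where
      shift : ∀ r s → f r s × (X ^ r * (Y * Y ^ s)) ≈ Y * (f r s × (X ^ r * Y ^ s))
      shift r s = trans (×-congʳ (f r s) (x∙yz≈y∙xz _ _ _)) (sym (×-comm-* (f r s) Y _))

    poly-shiftX : ∀ K L f → poly (suc K) L (shiftX f) ≈ X * poly K L f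
    poly-shiftX K L f = begin
      poly (suc K) L (shiftX f)
        ≈⟨ trans (sumTo-split-0 K _) (trans (+-congʳ (sumTo-zero L)) (+-identityˡ _)) ⟩
      sumTo K (λ r → sumTo L (λ s → f r s × (X * X ^ r * Y ^ s)))
        ≈⟨ sumTo-cong K (λ r → sumTo-cong L (shift r)) ⟩
      sumTo K (λ r → sumTo L (λ s → X * (f r s × (X ^ r * Y ^ s))))
        ≈⟨ sumTo-cong K (λ r → *-distribˡ-sumTo L X _) ⟨
      sumTo K (λ r → X * sumTo L (λ s → f r s × (X ^ r * Y ^ s)))
        ≈⟨ *-distribˡ-sumTo K X _ ⟨
      X * poly K L f
        ∎
      where
      shift : ∀ r s → f r s × (X * X ^ r * Y ^ s) ≈ X * (f r s × (X ^ r * Y ^ s))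
      shift r s = trans (×-congʳ (f r s) (*-assoc _ _ _)) (sym (×-comm-* (f r s) X _))

    poly-support : ∀ {k l K L} f → k ≤ K → l ≤ L →
                   (∀ r s → k < r → f r s ≡ 0) → (∀ r s → l < s → f r s ≡ 0) →
                   poly K L f ≈ poly k l f
    poly-support {k} {l} {K} f k≤K l≤L vanish-r vanish-s = trans
      (sumTo-cong K (λ r → sumTo-support _ l≤L (λ s l<s → ×-congˡ (vanish-s r s l<s))))
      (sumTo-support _ k≤K (λ r k<r →
        trans (sumTo-cong l (λ s → ×-congˡ (vanish-r r s k<r))) (sumTo-zero l)))

    A B : ℕ → Carrier
    A m = poly m (suc m) (a m)
    B m = poly m m (b m)

    A-enlarge : ∀ {m K L} → m ≤ K → suc m ≤ L → poly K L (a m) ≈ A m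
    A-enlarge m≤K m<L = poly-support _ m≤K m<L (λ r s → a-vanishes-r s) (λ r s → a-vanishes-s r)

    B-enlarge : ∀ {m K L} → m ≤ K → m ≤ L → poly K L (b m) ≈ B m
    B-enlarge m≤K m≤L = poly-support _ m≤K m≤L (λ r s → b-vanishes-r s) (λ r s → b-vanishes-s r)

    A-zero : A 0 ≈ 1# + Y
    A-zero = +-cong (trans (×-homo-1 _) (*-identityˡ 1#))
                    (trans (×-homo-1 _) (trans (*-identityˡ _) (*-identityʳ Y)))

    B-zero : B 0 ≈ 1#
    B-zero = trans (×-homo-1 _) (*-identityˡ 1#)

    A-suc : ∀ m → A (suc m) ≈ A m + Y * A m + X * B m
    A-suc m = begin
      A (suc m)
        ≈⟨ poly-cong K L (a-suc m) ⟩
      poly K L (λ r s → a+shiftY r s ℕ.+ shiftX (b m) r s)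
        ≈⟨ poly-+ K L a+shiftY (shiftX (b m)) ⟩
      poly K L a+shiftY + poly K L (shiftX (b m))
        ≈⟨ +-congʳ (poly-+ K L (a m) (shiftY (a m))) ⟩
      poly K L (a m) + poly K L (shiftY (a m)) + poly K L (shiftX (b m))
        ≈⟨ +-cong (+-cong A-box Y-box) X-box ⟩
      A m + Y * A m + X * B m
        ∎
      where
      K L : ℕ
      K = suc m
      L = suc (suc m)
      a+shiftY : Array
      a+shiftY r s = a m r s ℕ.+ shiftY (a m) r s
      A-box : poly K L (a m) ≈ A m
      A-box = A-enlarge (ℕ.n≤1+n m) (ℕ.n≤1+n (suc m))
      Y-box : poly K L (shiftY (a m)) ≈ Y * A m
      Y-box = trans (poly-shiftY K (suc m) _) (*-congˡ (A-enlarge (ℕ.n≤1+n m) ℕ.≤-refl))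
      X-box : poly K L (shiftX (b m)) ≈ X * B m
      X-box = trans (poly-shiftX m L _) (*-congˡ (B-enlarge ℕ.≤-refl (ℕ.m≤n+m m 2)))

    B-suc : ∀ m → B (suc m) ≈ A m + X * B m
    B-suc m = begin
      B (suc m)                                 ≈⟨ poly-cong K K (b-suc m) ⟩
      poly K K (λ r s → a m r s ℕ.+ shiftX (b m) r s)
                                                ≈⟨ poly-+ K K (a m) (shiftX (b m)) ⟩
      poly K K (a m) + poly K K (shiftX (b m))  ≈⟨ +-cong A-box X-box ⟩
      A m + X * B m                             ∎
      where
      K : ℕ
      K = suc m
      A-box : poly K K (a m) ≈ A m
      A-box = A-enlarge (ℕ.n≤1+n m) ℕ.≤-refl
      X-box : poly K K (shiftX (b m)) ≈ X * B m
      X-box = trans (poly-shiftX m K _) (*-congˡ (B-enlarge ℕ.≤-refl (ℕ.n≤1+n m)))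

  monomial-split : ∀ x y u v r s →
    x ^ r * y ^ s * u ^ (r ℕ.+ s) * v ^ (r ℕ.+ s) ≈ (x * (u * v)) ^ r * (y * (u * v)) ^ s
  monomial-split x y u v r s = sym (begin
    (x * (u * v)) ^ r * (y * (u * v)) ^ s
      ≈⟨ *-cong (^-distrib-* x (u * v) r) (^-distrib-* y (u * v) s) ⟩
    (x ^ r * (u * v) ^ r) * (y ^ s * (u * v) ^ s)
      ≈⟨ *-interchange _ _ _ _ ⟩
    (x ^ r * y ^ s) * ((u * v) ^ r * (u * v) ^ s)
      ≈⟨ *-congˡ (^-homo-* (u * v) r s) ⟨
    (x ^ r * y ^ s) * (u * v) ^ (r ℕ.+ s)
      ≈⟨ *-congˡ (^-distrib-* u v (r ℕ.+ s)) ⟩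
    (x ^ r * y ^ s) * (u ^ (r ℕ.+ s) * v ^ (r ℕ.+ s))
      ≈⟨ *-assoc _ _ _ ⟨
    x ^ r * y ^ s * u ^ (r ℕ.+ s) * v ^ (r ℕ.+ s)
      ∎)

  module LeftHandSide (x y u v : Carrier) where
    open GeneratingPolynomial (x * (u * v)) (y * (u * v))

    -- The only term of A m outside the triangle s ≤ m ∸ r of the left-hand side is a m 0 (suc m) = 1.
    A≈lhs+corner : ∀ m → A m ≈ Cor25.lhs R m x y u v + (y * (u * v)) ^ suc m
    A≈lhs+corner m = begin
      A m
        ≈⟨ sumTo-cong-except-0 m row-0 row-suc ⟩
      sumTo m (λ r → sumTo (m ∸ r) (term r)) + Y′ ^ suc m
        ≈⟨ +-congʳ (sumTo-cong m (λ r → sumTo-cong (m ∸ r) (term≈summand r))) ⟩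
      Cor25.lhs R m x y u v + Y′ ^ suc m
        ∎
      where
      Y′ : Carrier
      Y′ = y * (u * v)
      term : ℕ → ℕ → Carrier
      term r s = a m r s × ((x * (u * v)) ^ r * Y′ ^ s)
      row-0 : sumTo (suc m) (term 0) ≈ sumTo m (term 0) + Y′ ^ suc m
      row-0 = +-congˡ (trans (×-congˡ (a-corner m)) (trans (×-homo-1 _) (*-identityˡ _)))
      row-suc : ∀ r → sumTo (suc m) (term (suc r)) ≈ sumTo (m ∸ suc r) (term (suc r))
      row-suc r = sumTo-support _ (ℕ.≤-trans (ℕ.m∸n≤m m (suc r)) (ℕ.n≤1+n m))
                                  (λ s lt → ×-congˡ (a-beyond-diagonal m r lt))
      mono : ℕ → ℕ → Carrier
      mono r s = x ^ r * y ^ s * u ^ (r ℕ.+ s) * v ^ (r ℕ.+ s)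
      term≈summand : ∀ r s → term r s ≈ (suc (m ∸ r) C s) × (((m ∸ s) C r) × mono r s)
      term≈summand r s = trans (×-congʳ (a m r s) (sym (monomial-split x y u v r s)))
                               (sym (×-assocˡ (mono r s) (suc (m ∸ r) C s) ((m ∸ s) C r)))

  module ClosedForm (x y α : Carrier) (α-inverse : α * ((1# - x) * (1# - y)) ≈ 1#) where
    open GeneratingPolynomial (x * α) (y * α)

    D : Carrier
    D = 1# - x * y

    Â B̂ : ℕ → Carrier
    Â m = α ^ suc m * ((1# - x ^ suc (suc m) * y ^ suc (suc m)) - x * (1# - x ^ suc m * y ^ suc m))
    B̂ m = α ^ m * (1# - x ^ suc m * y ^ suc m)

    modulo-α-inverse : ∀ {l r} k → l ≈ r + k * (α * ((1# - x) * (1# - y)) - 1#) → l ≈ r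
    modulo-α-inverse {l} {r} k l≈r+ke = begin
      l                                         ≈⟨ l≈r+ke ⟩
      r + k * (α * ((1# - x) * (1# - y)) - 1#)  ≈⟨ +-congˡ (*-congˡ (+-congʳ α-inverse)) ⟩
      r + k * (1# - 1#)                         ≈⟨ +-congˡ (*-congˡ (-‿inverseʳ 1#)) ⟩
      r + k * 0#                                ≈⟨ +-congˡ (zeroʳ k) ⟩
      r + 0#                                    ≈⟨ +-identityʳ r ⟩
      r                                         ∎

    Â-suc : ∀ m → Â m + (y * α) * Â m + (x * α) * B̂ m ≈ Â (suc m)
    Â-suc m = modulo-α-inverse (α * α ^ m * (x * y * (x ^ suc m * y ^ suc m) - 1#))
      (solve 6 (λ x y α a p q →
          α :* a :* ((𝟏 :- (x :* p) :* (y :* q)) :- x :* (𝟏 :- p :* q))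
          :+ (y :* α) :* (α :* a :* ((𝟏 :- (x :* p) :* (y :* q)) :- x :* (𝟏 :- p :* q)))
          :+ (x :* α) :* (a :* (𝟏 :- p :* q))
        := α :* (α :* a)
             :* ((𝟏 :- (x :* (x :* p)) :* (y :* (y :* q))) :- x :* (𝟏 :- (x :* p) :* (y :* q)))
          :+ (α :* a :* (x :* y :* (p :* q) :- 𝟏)) :* (α :* ((𝟏 :- x) :* (𝟏 :- y)) :- 𝟏))
        refl x y α (α ^ m) (x ^ suc m) (y ^ suc m))

    B̂-suc : ∀ m → Â m + (x * α) * B̂ m ≈ B̂ (suc m)
    B̂-suc m = solve 6 (λ x y α a p q →
          α :* a :* ((𝟏 :- (x :* p) :* (y :* q)) :- x :* (𝟏 :- p :* q))
          :+ (x :* α) :* (a :* (𝟏 :- p :* q))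
        := α :* a :* (𝟏 :- (x :* p) :* (y :* q)))
      refl x y α (α ^ m) (x ^ suc m) (y ^ suc m)

    mutual
      A-closed-form : ∀ m → D * A m ≈ Â m
      A-closed-form zero    = trans (*-congˡ A-zero) (modulo-α-inverse (x * y - 1#)
        (solve 3 (λ x y α →
            (𝟏 :- x :* y) :* (𝟏 :+ y :* α)
          := α :* 𝟏
               :* ((𝟏 :- (x :* (x :* 𝟏)) :* (y :* (y :* 𝟏))) :- x :* (𝟏 :- (x :* 𝟏) :* (y :* 𝟏)))
            :+ (x :* y :- 𝟏) :* (α :* ((𝟏 :- x) :* (𝟏 :- y)) :- 𝟏))
          refl x y α))
      A-closed-form (suc m) = begin
        D * A (suc m)                                        ≈⟨ *-congˡ (A-suc m) ⟩
        D * (A m + (y * α) * A m + (x * α) * B m)            ≈⟨ distrib-D (A m) (B m) ⟩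
        D * A m + (y * α) * (D * A m) + (x * α) * (D * B m)  ≈⟨ +-cong (+-cong DA≈Â (*-congˡ DA≈Â))
                                                                       (*-congˡ (B-closed-form m)) ⟩
        Â m + (y * α) * Â m + (x * α) * B̂ m                  ≈⟨ Â-suc m ⟩
        Â (suc m)                                            ∎
        where
        DA≈Â : D * A m ≈ Â m
        DA≈Â = A-closed-form m
        distrib-D : ∀ P Q →
          D * (P + (y * α) * P + (x * α) * Q) ≈ D * P + (y * α) * (D * P) + (x * α) * (D * Q)
        distrib-D = solve 5 (λ x y α P Q →
            (𝟏 :- x :* y) :* (P :+ (y :* α) :* P :+ (x :* α) :* Q)
          := (𝟏 :- x :* y) :* P :+ (y :* α) :* ((𝟏 :- x :* y) :* P)
             :+ (x :* α) :* ((𝟏 :- x :* y) :* Q))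
          refl x y α

      B-closed-form : ∀ m → D * B m ≈ B̂ m
      B-closed-form zero    = trans (*-congˡ B-zero)
        (solve 2 (λ x y → (𝟏 :- x :* y) :* 𝟏 := 𝟏 :* (𝟏 :- (x :* 𝟏) :* (y :* 𝟏))) refl x y)
      B-closed-form (suc m) = begin
        D * B (suc m)                  ≈⟨ *-congˡ (B-suc m) ⟩
        D * (A m + (x * α) * B m)      ≈⟨ distrib-D (A m) (B m) ⟩
        D * A m + (x * α) * (D * B m)  ≈⟨ +-cong (A-closed-form m) (*-congˡ (B-closed-form m)) ⟩
        Â m + (x * α) * B̂ m            ≈⟨ B̂-suc m ⟩
        B̂ (suc m)                      ∎
        where
        distrib-D : ∀ P Q → D * (P + (x * α) * Q) ≈ D * P + (x * α) * (D * Q)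
        distrib-D = solve 5 (λ x y α P Q →
            (𝟏 :- x :* y) :* (P :+ (x :* α) :* Q)
          := (𝟏 :- x :* y) :* P :+ (x :* α) :* ((𝟏 :- x :* y) :* Q))
          refl x y α

  add-corner : ∀ w x y L Y →
    w * (1# - x * y) * L ≈ w * ((1# - x * y) * (L + Y) - (1# - x * y) * Y)
  add-corner = solve 5 (λ w x y L Y →
      w :* (𝟏 :- x :* y) :* L
    := w :* ((𝟏 :- x :* y) :* (L :+ Y) :- (𝟏 :- x :* y) :* Y))
    refl

  clear-denominator : ∀ x y w α′ p q →
    w * (α′ * ((1# - x * p * (y * q)) - x * (1# - p * q)) - (1# - x * y) * (q * α′))
      ≈ (1# - x * p * (y * q) - x * (1# - p * q) - (1# - x * y) * q) * w * α′
  clear-denominator = solve 6 (λ x y w α′ p q →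
      w :* (α′ :* ((𝟏 :- (x :* p) :* (y :* q)) :- x :* (𝟏 :- p :* q))
            :- (𝟏 :- x :* y) :* (q :* α′))
    := (𝟏 :- (x :* p) :* (y :* q) :- x :* (𝟏 :- p :* q) :- (𝟏 :- x :* y) :* q) :* w :* α′)
    refl

corollary2p5 : ∀ {c ℓ : Level} (R : CommutativeRing c ℓ) (m : ℕ)
    (x y u v w : CommutativeRing.Carrier R) →
    let open CommutativeRing R in
    u * (1# - x) ≈ 1# → v * (1# - y) ≈ 1# → w * (1# - x * y) ≈ 1# →
    Cor25.lhs R m x y u v ≈ Cor25.rhs R m x y u v w
corollary2p5 R m x y u v w u-inverse v-inverse w-inverse = begin
  L                                ≈⟨ trans (*-congʳ w-inverse) (*-identityˡ L) ⟨
  w * D * L                        ≈⟨ add-corner R w x y L Y′ ⟩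
  w * (D * (L + Y′) - D * Y′)      ≈⟨ *-congˡ (+-cong (*-congˡ (A≈lhs+corner m))
                                                       (-‿cong (*-congˡ qα′≈Y′))) ⟨
  w * (D * A m - D * (q * α′))     ≈⟨ *-congˡ (+-congʳ (A-closed-form m)) ⟩
  w * (Â m - D * (q * α′))         ≈⟨ clear-denominator R x y w α′ p q ⟩
  N * w * α′                       ≈⟨ *-congˡ (^-distrib-* u v (suc m)) ⟩
  N * w * (u ^ suc m * v ^ suc m)  ≈⟨ *-assoc _ _ _ ⟨
  Cor25.rhs R m x y u v w          ∎
  where
  open CommutativeRing R
  open RawSemiring (Semiring.rawSemiring semiring) using (_^_)
  open import Algebra.Properties.CommutativeSemigroup *-commutativeSemigroup using (interchange)
  open import Algebra.Properties.CommutativeSemiring.Exp commutativeSemiring using (^-distrib-*)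
  open import Relation.Binary.Reasoning.Setoid setoid

  α : Carrier
  α = u * v

  α-inverse : α * ((1# - x) * (1# - y)) ≈ 1#
  α-inverse = trans (interchange u v (1# - x) (1# - y))
                    (trans (*-cong u-inverse v-inverse) (*-identityˡ 1#))

  open GeneratingPolynomial R (x * α) (y * α) using (A)
  open ClosedForm R x y α α-inverse using (D; Â; A-closed-form)
  open LeftHandSide R x y u v using (A≈lhs+corner)

  L p q α′ Y′ N : Carrier
  L  = Cor25.lhs R m x y u v
  p  = x ^ suc m
  q  = y ^ suc m
  α′ = α ^ suc m
  Y′ = (y * α) ^ suc m
  N  = 1# - x * p * (y * q) - x * (1# - p * q) - D * q

  qα′≈Y′ : q * α′ ≈ Y′
  qα′≈Y′ = sym (^-distrib-* y α (suc m))
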